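{- Let $v\geq 1$ and $L,M\geq 0$ be integers. Then \[ \sum_{j=-\infty}^{\infty}(-1)^jq^{vj^2}{L+M-(v-1)j \brack L-vj}_q{L+v+M+(v-1)j \brack L+v+vj}_q=\sum_{j=-\infty}^{\infty}(-1)^jq^{vj^2}{L+M-(v-1)j \brack L-vj}_q{L+v-1+M+(v-1)j \brack L+v-1+vj}_q . \]
   Context: For integers $n\ge0$, $(q)_n=\prod_{j=1}^{n}(1-q^j)$. For integers $m,n$, ${n+m \brack n}_q=\frac{(q)_{n+m}}{(q)_n(q)_m}$ if $m,n\geq 0$ and $0$ otherwise. -}

module Defs where

-- Formal power series in q with integer coefficients, represented by their
-- coefficient functions  ℕ → ℤ  (coefficient of q^k).  The q-binomial coefficients are polynomials,
-- hence in particular elements of ℤ[[q]], and the paper's defining quotient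
-- (q)_{n+m} / ((q)_n (q)_m) is computed in ℤ[[q]], where every (q)_n is a unit
-- (constant term 1).

open import Data.Nat as ℕ using (ℕ; zero; suc)
open import Data.Integer as ℤ using (ℤ; +_; -[1+_])
open import Data.Bool using (if_then_else_)
open import Relation.Binary.PropositionalEquality using (_≡_)
open import Relation.Nullary.Decidable using (⌊_⌋)

PS : Set
PS = ℕ → ℤ

_≋_ : PS → PS → Set
f ≋ g = ∀ k → f k ≡ g k

sumTo : (ℕ → ℤ) → ℕ → ℤ
sumTo f zero    = f 0
sumTo f (suc n) = sumTo f n ℤ.+ f (suc n)

zeroPS : PS
zeroPS _ = + 0

onePS : PS
onePS zero    = + 1
onePS (suc _) = + 0

qPow : ℕ → PS
qPow n k = if ⌊ k ℕ.≟ n ⌋ then + 1 else + 0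

_⊕_ : PS → PS → PS
(f ⊕ g) k = f k ℤ.+ g k

_⊖_ : PS → PS → PS
(f ⊖ g) k = f k ℤ.- g k

_⊛_ : PS → PS → PS
(f ⊛ g) k = sumTo (λ i → f i ℤ.* g (k ℕ.∸ i)) k

infixl 7 _⊛_
infixl 6 _⊕_ _⊖_

_·_ : ℤ → PS → PS
(c · f) k = c ℤ.* f k

qPoch : ℕ → PS
qPoch zero    = onePS
qPoch (suc n) = qPoch n ⊛ (onePS ⊖ qPow (suc n))

-- Multiplicative inverse in ℤ[[q]] of a series f with constant term 1:
-- b_0 = 1,  b_k = - Σ_{i=1}^{k} f_i b_{k-i}.
-- invUpTo f k is correct on indices ≤ k.
invUpTo : PS → ℕ → PS
invUpTo f zero    = onePS
invUpTo f (suc k) i =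
  if ⌊ i ℕ.≟ suc k ⌋
  then ℤ.- sumTo (λ t → f (suc t) ℤ.* invUpTo f k (k ℕ.∸ t)) k
  else invUpTo f k i

inv : PS → PS
inv f k = invUpTo f k k

-- Gaussian binomial  [n+m choose n]_q  for integers n, m, as in the paper:
-- (q)_{n+m} / ((q)_n (q)_m) if n, m ≥ 0, and 0 otherwise.
qbinNM : ℤ → ℤ → PS
qbinNM (+ n) (+ m) = qPoch (n ℕ.+ m) ⊛ inv (qPoch n) ⊛ inv (qPoch m)
qbinNM (+ n) -[1+ m ] = zeroPS
qbinNM -[1+ n ] _     = zeroPS

qbin : ℤ → ℤ → PS
qbin T B = qbinNM B (T ℤ.- B)

signZ : ℤ → ℤ
signZ j = (ℤ.- + 1) ℤ.^ ℤ.∣ j ∣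

bisum : ℕ → (ℤ → PS) → PS
bisum N F k = sumTo (λ i → F ((+ i) ℤ.- (+ N)) k) (N ℕ.+ N)

{-# OPTIONS --safe #-}
module Submission where

-- Write ⟨n, m⟩ for the bracket [n+m ; n] (qbinNM n m).  Pascal's rule
-- ⟨n, m⟩ = ⟨n-1, m⟩ + q^n ⟨n, m-1⟩, applied to the second bracket of the left-hand
-- side, splits its j-th summand into the j-th summand of the right-hand side plus
-- R j = (-1)^j q^{v j² + L+v+vj} ⟨L-vj, M+j⟩ ⟨L+v+vj, M-1-j⟩.  The reflection
-- j ↦ -1-j exchanges the two brackets of R j and keeps its power of q, since
-- v j² + (L+v+vj) = v (j+1)² + (L-vj), but flips the sign.  Hence the R j cancel
-- in pairs over -N ≤ j ≤ N-1, and R N = 0 because M-1-N < 0.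

open import Defs
open import Data.Nat as ℕ using (ℕ; zero; suc; _≤_; _<_; z≤n; s≤s; _∸_)
import Data.Nat.Properties as ℕ
open import Data.Integer as ℤ using (ℤ; +_; -[1+_])
import Data.Integer.Properties as ℤ
open import Data.Integer.Tactic.RingSolver using (solve-∀)
open import Data.Empty using (⊥-elim)
open import Data.Maybe using (just; nothing)
open import Data.Product using (_×_; _,_)
open import Data.Sum using (inj₁; inj₂)
open import Relation.Nullary using (¬_; yes; no)
open import Relation.Binary.PropositionalEquality
open import Relation.Binary.Structures using (IsEquivalence)
open import Algebra.Bundles using (CommutativeRing)
open import Algebra.Structures using (IsCommutativeRing)
import Algebra.Properties.CommutativeSemigroup as CommutativeSemigroupProperties
open import Algebra.Solver.Ring.AlmostCommutativeRing
  using (_-Raw-AlmostCommutative⟶_; fromCommutativeRing)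
import Algebra.Solver.Ring as RingSolver
import Algebra.Properties.Ring as RingProperties
import Relation.Binary.Reasoning.Setoid as SetoidReasoning
open import Relation.Binary.Definitions using (WeaklyDecidable)

-- Finite sums

sumTo-cong : ∀ {f g : ℕ → ℤ} n → (∀ i → i ≤ n → f i ≡ g i) → sumTo f n ≡ sumTo g n
sumTo-cong zero    f≡g = f≡g 0 z≤n
sumTo-cong (suc n) f≡g =
  cong₂ ℤ._+_ (sumTo-cong n (λ i i≤n → f≡g i (ℕ.m≤n⇒m≤1+n i≤n))) (f≡g (suc n) ℕ.≤-refl)

sumTo-zero : ∀ {f : ℕ → ℤ} n → (∀ i → i ≤ n → f i ≡ + 0) → sumTo f n ≡ + 0
sumTo-zero {f} n f≡0 = trans (sumTo-cong n f≡0) (sumTo-const n)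
  where
  sumTo-const : ∀ n → sumTo (λ _ → + 0) n ≡ + 0
  sumTo-const zero    = refl
  sumTo-const (suc n) = cong (ℤ._+ + 0) (sumTo-const n)

sumTo-+ : ∀ (f g : ℕ → ℤ) n → sumTo (λ i → f i ℤ.+ g i) n ≡ sumTo f n ℤ.+ sumTo g n
sumTo-+ f g zero    = refl
sumTo-+ f g (suc n) = trans (cong (ℤ._+ (f (suc n) ℤ.+ g (suc n))) (sumTo-+ f g n))
  (CommutativeSemigroupProperties.interchange ℤ.+-commutativeSemigroup
    (sumTo f n) (sumTo g n) (f (suc n)) (g (suc n)))

sumTo-* : ∀ (c : ℤ) (f : ℕ → ℤ) n → sumTo (λ i → c ℤ.* f i) n ≡ c ℤ.* sumTo f n
sumTo-* c f zero    = refl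
sumTo-* c f (suc n) = trans (cong (ℤ._+ (c ℤ.* f (suc n))) (sumTo-* c f n))
  (sym (ℤ.*-distribˡ-+ c (sumTo f n) (f (suc n))))

sumTo-neg : ∀ (f : ℕ → ℤ) n → sumTo (λ i → ℤ.- f i) n ≡ ℤ.- sumTo f n
sumTo-neg f zero    = refl
sumTo-neg f (suc n) = trans (cong (ℤ._+ (ℤ.- f (suc n))) (sumTo-neg f n))
  (sym (ℤ.neg-distrib-+ (sumTo f n) (f (suc n))))

sumTo-suc : ∀ (f : ℕ → ℤ) n → sumTo f (suc n) ≡ f 0 ℤ.+ sumTo (λ i → f (suc i)) n
sumTo-suc f zero    = refl
sumTo-suc f (suc n) = begin
  sumTo f (suc n) ℤ.+ f (suc (suc n))                   ≡⟨ cong (ℤ._+ f (suc (suc n))) (sumTo-suc f n) ⟩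
  f 0 ℤ.+ sumTo (λ i → f (suc i)) n ℤ.+ f (suc (suc n)) ≡⟨ ℤ.+-assoc (f 0) _ _ ⟩
  f 0 ℤ.+ (sumTo (λ i → f (suc i)) n ℤ.+ f (suc (suc n))) ∎
  where open ≡-Reasoning

sumTo-reverse : ∀ (f : ℕ → ℤ) n → sumTo f n ≡ sumTo (λ i → f (n ∸ i)) n
sumTo-reverse f zero    = refl
sumTo-reverse f (suc n) = begin
  sumTo f n ℤ.+ f (suc n)                 ≡⟨ cong (ℤ._+ f (suc n)) (sumTo-reverse f n) ⟩
  sumTo (λ i → f (n ∸ i)) n ℤ.+ f (suc n) ≡⟨ ℤ.+-comm _ (f (suc n)) ⟩
  f (suc n) ℤ.+ sumTo (λ i → f (n ∸ i)) n ≡⟨ sym (sumTo-suc (λ i → f (suc n ∸ i)) n) ⟩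
  sumTo (λ i → f (suc n ∸ i)) (suc n)     ∎
  where open ≡-Reasoning

-- Both sides sum H over the triangle 0 ≤ a ≤ i ≤ k.
sumTo-exchange : ∀ (H : ℕ → ℕ → ℤ) k →
  sumTo (λ i → sumTo (λ a → H a i) i) k ≡ sumTo (λ a → sumTo (λ t → H a (a ℕ.+ t)) (k ∸ a)) k
sumTo-exchange H zero    = refl
sumTo-exchange H (suc k) = begin
  sumTo (λ i → sumTo (λ a → H a i) i) k ℤ.+ sumTo (λ a → H a (suc k)) (suc k)
    ≡⟨ cong (ℤ._+ sumTo (λ a → H a (suc k)) (suc k)) (sumTo-exchange H k) ⟩
  sumTo (λ a → Row a (k ∸ a)) k ℤ.+ (sumTo (λ a → H a (suc k)) k ℤ.+ H (suc k) (suc k))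
    ≡⟨ sym (ℤ.+-assoc (sumTo (λ a → Row a (k ∸ a)) k) _ _) ⟩
  sumTo (λ a → Row a (k ∸ a)) k ℤ.+ sumTo (λ a → H a (suc k)) k ℤ.+ H (suc k) (suc k)
    ≡⟨ cong (ℤ._+ H (suc k) (suc k)) (sym (sumTo-+ (λ a → Row a (k ∸ a)) (λ a → H a (suc k)) k)) ⟩
  sumTo (λ a → Row a (k ∸ a) ℤ.+ H a (suc k)) k ℤ.+ H (suc k) (suc k)
    ≡⟨ cong₂ ℤ._+_ (sumTo-cong k extend-row) last-row ⟩
  sumTo (λ a → Row a (suc k ∸ a)) k ℤ.+ Row (suc k) (k ∸ k) ∎
  where
  open ≡-Reasoning
  Row : ℕ → ℕ → ℤ
  Row a m = sumTo (λ t → H a (a ℕ.+ t)) m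
  last-row : H (suc k) (suc k) ≡ Row (suc k) (k ∸ k)
  last-row = begin
    H (suc k) (suc k)       ≡⟨ cong (H (suc k)) (sym (ℕ.+-identityʳ (suc k))) ⟩
    Row (suc k) 0           ≡⟨ cong (Row (suc k)) (sym (ℕ.n∸n≡0 k)) ⟩
    Row (suc k) (k ∸ k)     ∎
  extend-row : ∀ a → a ≤ k → Row a (k ∸ a) ℤ.+ H a (suc k) ≡ Row a (suc k ∸ a)
  extend-row a a≤k = begin
    Row a (k ∸ a) ℤ.+ H a (suc k)             ≡⟨ cong (λ i → Row a (k ∸ a) ℤ.+ H a i) suc-k ⟩
    Row a (k ∸ a) ℤ.+ H a (a ℕ.+ suc (k ∸ a)) ≡⟨ cong (Row a) (sym (ℕ.+-∸-assoc 1 a≤k)) ⟩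
    Row a (suc k ∸ a)                         ∎
    where
    suc-k : suc k ≡ a ℕ.+ suc (k ∸ a)
    suc-k = trans (cong suc (sym (ℕ.m+[n∸m]≡n a≤k))) (sym (ℕ.+-suc a (k ∸ a)))

-- The ring ℤ[[q]]

-- Defs gives _≋_ no fixity; this alias binds looser than _⊕_ and _⊛_.
infix 4 _≈_
_≈_ : PS → PS → Set
_≈_ = _≋_

≡⇒≈ : ∀ {f g : PS} → f ≡ g → f ≈ g
≡⇒≈ refl _ = refl

negPS : PS → PS
negPS f k = ℤ.- f k

⊛-cong : ∀ {f f' g g'} → f ≈ f' → g ≈ g' → f ⊛ g ≈ f' ⊛ g'
⊛-cong f≈f' g≈g' k = sumTo-cong k (λ i _ → cong₂ ℤ._*_ (f≈f' i) (g≈g' (k ∸ i)))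

⊛-comm : ∀ f g → f ⊛ g ≈ g ⊛ f
⊛-comm f g k = trans (sumTo-reverse _ k) (sumTo-cong k λ i i≤k →
  trans (cong (λ j → f (k ∸ i) ℤ.* g j) (ℕ.m∸[m∸n]≡n i≤k)) (ℤ.*-comm (f (k ∸ i)) (g i)))

⊛-assoc : ∀ f g h → (f ⊛ g) ⊛ h ≈ f ⊛ (g ⊛ h)
⊛-assoc f g h k = begin
  sumTo (λ i → sumTo (λ a → f a ℤ.* g (i ∸ a)) i ℤ.* h (k ∸ i)) k
    ≡⟨ sumTo-cong k (λ i _ → trans (ℤ.*-comm _ (h (k ∸ i))) (sym (sumTo-* (h (k ∸ i)) _ i))) ⟩
  sumTo (λ i → sumTo (λ a → H a i) i) k
    ≡⟨ sumTo-exchange H k ⟩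
  sumTo (λ a → sumTo (λ t → H a (a ℕ.+ t)) (k ∸ a)) k
    ≡⟨ sumTo-cong k (λ a _ →
         trans (sumTo-cong (k ∸ a) (λ t _ → H-shift a t)) (sumTo-* (f a) _ (k ∸ a))) ⟩
  sumTo (λ a → f a ℤ.* sumTo (λ t → g t ℤ.* h (k ∸ a ∸ t)) (k ∸ a)) k ∎
  where
  open ≡-Reasoning
  H : ℕ → ℕ → ℤ
  H a i = h (k ∸ i) ℤ.* (f a ℤ.* g (i ∸ a))
  rotate : ∀ x y z → x ℤ.* (y ℤ.* z) ≡ y ℤ.* (z ℤ.* x)
  rotate = solve-∀
  H-shift : ∀ a t → H a (a ℕ.+ t) ≡ f a ℤ.* (g t ℤ.* h (k ∸ a ∸ t))
  H-shift a t = trans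
    (cong₂ (λ i j → h i ℤ.* (f a ℤ.* g j)) (sym (ℕ.∸-+-assoc k a t)) (ℕ.m+n∸m≡n a t))
    (rotate (h (k ∸ a ∸ t)) (f a) (g t))

⊛-distribˡ-⊕ : ∀ f g h → f ⊛ (g ⊕ h) ≈ f ⊛ g ⊕ f ⊛ h
⊛-distribˡ-⊕ f g h k =
  trans (sumTo-cong k (λ i _ → ℤ.*-distribˡ-+ (f i) (g (k ∸ i)) (h (k ∸ i)))) (sumTo-+ _ _ k)

⊛-identityˡ : ∀ f → onePS ⊛ f ≈ f
⊛-identityˡ f zero    = ℤ.*-identityˡ (f 0)
⊛-identityˡ f (suc k) = begin
  sumTo (λ i → onePS i ℤ.* f (suc k ∸ i)) (suc k)          ≡⟨ sumTo-suc _ k ⟩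
  + 1 ℤ.* f (suc k) ℤ.+ sumTo (λ i → + 0 ℤ.* f (k ∸ i)) k
    ≡⟨ cong₂ ℤ._+_ (ℤ.*-identityˡ (f (suc k))) (sumTo-zero k (λ i _ → ℤ.*-zeroˡ (f (k ∸ i)))) ⟩
  f (suc k) ℤ.+ + 0                                        ≡⟨ ℤ.+-identityʳ _ ⟩
  f (suc k)                                                ∎
  where open ≡-Reasoning

⊛-zeroʳ : ∀ f → f ⊛ zeroPS ≈ zeroPS
⊛-zeroʳ f k = sumTo-zero k (λ i _ → ℤ.*-zeroʳ (f i))

PS-isCommutativeRing : IsCommutativeRing _≈_ _⊕_ _⊛_ negPS zeroPS onePS
PS-isCommutativeRing = record
  { isRing = record
    { +-isAbelianGroup = record
      { isGroup = record
        { isMonoid = record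
          { isSemigroup = record
            { isMagma = record
              { isEquivalence = ≈-isEquivalence
              ; ∙-cong = λ f≈f' g≈g' k → cong₂ ℤ._+_ (f≈f' k) (g≈g' k) }
            ; assoc = λ f g h k → ℤ.+-assoc (f k) (g k) (h k) }
          ; identity = (λ f k → ℤ.+-identityˡ (f k)) , (λ f k → ℤ.+-identityʳ (f k)) }
        ; inverse = (λ f k → ℤ.+-inverseˡ (f k)) , (λ f k → ℤ.+-inverseʳ (f k))
        ; ⁻¹-cong = λ f≈g k → cong ℤ.-_ (f≈g k) }
      ; comm = λ f g k → ℤ.+-comm (f k) (g k) }
    ; *-cong = ⊛-cong
    ; *-assoc = ⊛-assoc
    ; *-identity = ⊛-identityˡ , (λ f k → trans (⊛-comm f onePS k) (⊛-identityˡ f k))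
    ; distrib = ⊛-distribˡ-⊕
              , (λ f g h k → trans (⊛-comm (g ⊕ h) f k) (trans (⊛-distribˡ-⊕ f g h k)
                   (cong₂ ℤ._+_ (⊛-comm f g k) (⊛-comm f h k)))) }
  ; *-comm = ⊛-comm }
  where
  ≈-isEquivalence : IsEquivalence _≈_
  ≈-isEquivalence = record
    { refl  = λ _ → refl
    ; sym   = λ f≈g k → sym (f≈g k)
    ; trans = λ f≈g g≈h k → trans (f≈g k) (g≈h k) }

PS-commutativeRing : CommutativeRing _ _
PS-commutativeRing = record { isCommutativeRing = PS-isCommutativeRing }

open CommutativeRing PS-commutativeRing
  using (+-cong; zeroˡ; *-identityˡ; *-identityʳ; +-identityˡ; +-identityʳ)
  renaming (refl to ≈-refl; sym to ≈-sym; trans to ≈-trans; setoid to PS-setoid; ring to PS-ring)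
open SetoidReasoning PS-setoid
open RingProperties PS-ring using (-‿distribʳ-*)

⊛-congʳ : ∀ h {f g} → f ≈ g → f ⊛ h ≈ g ⊛ h
⊛-congʳ h f≈g = ⊛-cong f≈g (≈-refl {h})

⊛-congˡ : ∀ h {f g} → f ≈ g → h ⊛ f ≈ h ⊛ g
⊛-congˡ h f≈g = ⊛-cong (≈-refl {h}) f≈g

⊛-cancelʳ-unit : ∀ f g u w → u ⊛ w ≈ onePS → f ⊛ u ≈ g ⊛ u → f ≈ g
⊛-cancelʳ-unit f g u w uw≈1 fu≈gu = begin
  f                ≈⟨ ≈-sym (*-identityʳ f) ⟩
  f ⊛ onePS        ≈⟨ ⊛-congˡ f (≈-sym uw≈1) ⟩
  f ⊛ (u ⊛ w)      ≈⟨ ≈-sym (⊛-assoc f u w) ⟩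
  (f ⊛ u) ⊛ w      ≈⟨ ⊛-congʳ w fu≈gu ⟩
  (g ⊛ u) ⊛ w      ≈⟨ ⊛-assoc g u w ⟩
  g ⊛ (u ⊛ w)      ≈⟨ ⊛-congˡ g uw≈1 ⟩
  g ⊛ onePS        ≈⟨ *-identityʳ g ⟩
  g                ∎

·-⊛ : ∀ c f g → (c · f) ⊛ g ≈ c · (f ⊛ g)
·-⊛ c f g k = trans (sumTo-cong k (λ i _ → ℤ.*-assoc c (f i) (g (k ∸ i)))) (sumTo-* c _ k)

constPS : ℤ → PS
constPS c = c · onePS

constPS-homomorphism : ℤ.+-*-rawRing -Raw-AlmostCommutative⟶ fromCommutativeRing PS-commutativeRing
constPS-homomorphism = record
  { ⟦_⟧    = constPS
  ; +-homo = λ a b k → ℤ.*-distribʳ-+ (onePS k) a b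
  ; *-homo = λ a b k → trans (ℤ.*-assoc a b (onePS k)) (sym
      (trans (·-⊛ a onePS (constPS b) k) (cong (a ℤ.*_) (⊛-identityˡ (constPS b) k))))
  ; -‿homo = λ a k → sym (ℤ.neg-distribˡ-* a (onePS k))
  ; 0-homo = λ k → ℤ.*-zeroˡ (onePS k)
  ; 1-homo = λ k → ℤ.*-identityˡ (onePS k) }

constPS-≟ : WeaklyDecidable (λ a b → constPS a ≈ constPS b)
constPS-≟ a b with a ℤ.≟ b
... | yes refl = just ≈-refl
... | no _     = nothing

-- With coefficients in ℤ, constant arithmetic computes, so the solver's normal forms
-- agree definitionally.
open RingSolver ℤ.+-*-rawRing (fromCommutativeRing PS-commutativeRing) constPS-homomorphism constPS-≟
  using (solve; _:=_; _:+_; _:*_; :-_)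

qPow-≡ : ∀ {a k} → k ≡ a → qPow a k ≡ + 1
qPow-≡ {a} {k} k≡a with k ℕ.≟ a
... | yes _   = refl
... | no k≢a  = ⊥-elim (k≢a k≡a)

qPow-≢ : ∀ {a k} → ¬ k ≡ a → qPow a k ≡ + 0
qPow-≢ {a} {k} k≢a with k ℕ.≟ a
... | yes k≡a = ⊥-elim (k≢a k≡a)
... | no _    = refl

sumTo-qPow-* : ∀ a (g : ℕ → ℤ) n → a ≤ n → sumTo (λ i → qPow a i ℤ.* g i) n ≡ g a
sumTo-qPow-*-< : ∀ a (g : ℕ → ℤ) n → n < a → sumTo (λ i → qPow a i ℤ.* g i) n ≡ + 0
sumTo-qPow-*-< a g n n<a = sumTo-zero n (λ i i≤n →
  trans (cong (ℤ._* g i) (qPow-≢ (ℕ.<⇒≢ (ℕ.≤-<-trans i≤n n<a)))) (ℤ.*-zeroˡ (g i)))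
sumTo-qPow-* a g zero z≤n = trans (cong (ℤ._* g 0) (qPow-≡ {0} refl)) (ℤ.*-identityˡ (g 0))
sumTo-qPow-* a g (suc n) a≤1+n with ℕ.m≤n⇒m<n∨m≡n a≤1+n
... | inj₁ a<1+n = trans
  (cong₂ ℤ._+_ (sumTo-qPow-* a g n (ℕ.≤-pred a<1+n))
    (trans (cong (ℤ._* g (suc n)) (qPow-≢ (λ 1+n≡a → ℕ.<⇒≢ a<1+n (sym 1+n≡a))))
           (ℤ.*-zeroˡ (g (suc n)))))
  (ℤ.+-identityʳ (g a))
... | inj₂ refl = trans
  (cong₂ ℤ._+_ (sumTo-qPow-*-< (suc n) g n ℕ.≤-refl)
    (trans (cong (ℤ._* g (suc n)) (qPow-≡ {suc n} refl)) (ℤ.*-identityˡ (g (suc n)))))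
  (ℤ.+-identityˡ (g (suc n)))

qPow-+ : ∀ a b → qPow a ⊛ qPow b ≈ qPow (a ℕ.+ b)
qPow-+ a b k with a ℕ.≤? k
... | no a≰k = trans (sumTo-qPow-*-< a (λ i → qPow b (k ∸ i)) k (ℕ.≰⇒> a≰k))
  (sym (qPow-≢ (λ k≡a+b → a≰k (subst (a ℕ.≤_) (sym k≡a+b) (ℕ.m≤m+n a b)))))
... | yes a≤k with k ∸ a ℕ.≟ b
...   | yes k-a≡b = trans (sumTo-qPow-* a (λ i → qPow b (k ∸ i)) k a≤k)
  (trans (qPow-≡ k-a≡b) (sym (qPow-≡ (trans (sym (ℕ.m+[n∸m]≡n a≤k)) (cong (a ℕ.+_) k-a≡b)))))
...   | no k-a≢b = trans (sumTo-qPow-* a (λ i → qPow b (k ∸ i)) k a≤k)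
  (trans (qPow-≢ k-a≢b)
         (sym (qPow-≢ (λ k≡a+b → k-a≢b (trans (cong (_∸ a) k≡a+b) (ℕ.m+n∸m≡n a b))))))

qPow-zero : qPow 0 ≈ onePS
qPow-zero zero    = refl
qPow-zero (suc k) = refl

-- Inverses of series with constant term 1

invUpTo-suc : ∀ f k i → i ≤ k → invUpTo f (suc k) i ≡ invUpTo f k i
invUpTo-suc f k i i≤k with i ℕ.≟ suc k
... | yes i≡1+k = ⊥-elim (ℕ.<⇒≢ (s≤s i≤k) i≡1+k)
... | no _      = refl

invUpTo≡inv : ∀ f k i → i ≤ k → invUpTo f k i ≡ inv f i
invUpTo≡inv f zero    zero z≤n = refl
invUpTo≡inv f (suc k) i i≤1+k with ℕ.m≤n⇒m<n∨m≡n i≤1+k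
... | inj₁ i<1+k = trans (invUpTo-suc f k i (ℕ.≤-pred i<1+k)) (invUpTo≡inv f k i (ℕ.≤-pred i<1+k))
... | inj₂ refl  = refl

inv-suc : ∀ f k → inv f (suc k) ≡ ℤ.- sumTo (λ t → f (suc t) ℤ.* inv f (k ∸ t)) k
inv-suc f k with suc k ℕ.≟ suc k
... | no ≢refl = ⊥-elim (≢refl refl)
... | yes _   =
  cong ℤ.-_ (sumTo-cong k (λ t _ → cong (f (suc t) ℤ.*_) (invUpTo≡inv f k (k ∸ t) (ℕ.m∸n≤m k t))))

⊛-inverseʳ : ∀ f → f 0 ≡ + 1 → f ⊛ inv f ≈ onePS
⊛-inverseʳ f f0≡1 zero    = cong (ℤ._* + 1) f0≡1
⊛-inverseʳ f f0≡1 (suc k) = trans (sumTo-suc _ k)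
  (trans (cong₂ (λ c d → c ℤ.* d ℤ.+ s) f0≡1 (inv-suc f k)) (cancel s))
  where
  s = sumTo (λ t → f (suc t) ℤ.* inv f (k ∸ t)) k
  cancel : ∀ s → + 1 ℤ.* ℤ.- s ℤ.+ s ≡ + 0
  cancel = solve-∀

-- q-binomial coefficients

qPoch-constant : ∀ n → qPoch n 0 ≡ + 1
qPoch-constant zero    = refl
qPoch-constant (suc n) = cong (ℤ._* (+ 1 ℤ.- + 0)) (qPoch-constant n)

qPoch-inverse : ∀ n → qPoch n ⊛ inv (qPoch n) ≈ onePS
qPoch-inverse n = ⊛-inverseʳ (qPoch n) (qPoch-constant n)

qPoch-product-inverse : ∀ n m → (qPoch n ⊛ qPoch m) ⊛ (inv (qPoch n) ⊛ inv (qPoch m)) ≈ onePS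
qPoch-product-inverse n m = begin
  (qPoch n ⊛ qPoch m) ⊛ (inv (qPoch n) ⊛ inv (qPoch m))
    ≈⟨ interchange (qPoch n) (qPoch m) (inv (qPoch n)) (inv (qPoch m)) ⟩
  (qPoch n ⊛ inv (qPoch n)) ⊛ (qPoch m ⊛ inv (qPoch m))
    ≈⟨ ⊛-cong (qPoch-inverse n) (qPoch-inverse m) ⟩
  onePS ⊛ onePS ≈⟨ *-identityˡ onePS ⟩
  onePS         ∎
  where
  interchange : ∀ a b c d → (a ⊛ b) ⊛ (c ⊛ d) ≈ (a ⊛ c) ⊛ (b ⊛ d)
  interchange = solve 4 (λ a b c d → (a :* b) :* (c :* d) := (a :* c) :* (b :* d)) (λ _ → refl)

qbinNM-correct : ∀ n m → qbinNM (+ n) (+ m) ⊛ (qPoch n ⊛ qPoch m) ≈ qPoch (n ℕ.+ m)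
qbinNM-correct n m = begin
  (qPoch (n ℕ.+ m) ⊛ inv (qPoch n) ⊛ inv (qPoch m)) ⊛ (qPoch n ⊛ qPoch m)
    ≈⟨ regroup (qPoch (n ℕ.+ m)) (qPoch n) (qPoch m) (inv (qPoch n)) (inv (qPoch m)) ⟩
  qPoch (n ℕ.+ m) ⊛ ((qPoch n ⊛ qPoch m) ⊛ (inv (qPoch n) ⊛ inv (qPoch m)))
    ≈⟨ ⊛-congˡ (qPoch (n ℕ.+ m)) (qPoch-product-inverse n m) ⟩
  qPoch (n ℕ.+ m) ⊛ onePS ≈⟨ *-identityʳ _ ⟩
  qPoch (n ℕ.+ m)         ∎
  where
  regroup : ∀ p a b c d → (p ⊛ c ⊛ d) ⊛ (a ⊛ b) ≈ p ⊛ ((a ⊛ b) ⊛ (c ⊛ d))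
  regroup = solve 5 (λ p a b c d → (p :* c :* d) :* (a :* b) := p :* ((a :* b) :* (c :* d))) (λ _ → refl)

qbinNM-unique : ∀ n m f → f ⊛ (qPoch n ⊛ qPoch m) ≈ qPoch (n ℕ.+ m) → qbinNM (+ n) (+ m) ≈ f
qbinNM-unique n m f f-correct =
  ⊛-cancelʳ-unit _ f (qPoch n ⊛ qPoch m) (inv (qPoch n) ⊛ inv (qPoch m)) (qPoch-product-inverse n m)
    (≈-trans (qbinNM-correct n m) (≈-sym f-correct))

qbinNM-n0 : ∀ n → qbinNM (+ n) (+ 0) ≈ onePS
qbinNM-n0 n = qbinNM-unique n 0 onePS (begin
  onePS ⊛ (qPoch n ⊛ onePS) ≈⟨ *-identityˡ _ ⟩
  qPoch n ⊛ onePS           ≈⟨ *-identityʳ _ ⟩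
  qPoch n                   ≈⟨ ≡⇒≈ (cong qPoch (sym (ℕ.+-identityʳ n))) ⟩
  qPoch (n ℕ.+ 0)           ∎)

qbinNM-0m : ∀ m → qbinNM (+ 0) (+ m) ≈ onePS
qbinNM-0m m = qbinNM-unique 0 m onePS (≈-trans (*-identityˡ _) (*-identityˡ _))

qbinNM-negʳ : ∀ n m → qbinNM n -[1+ m ] ≡ zeroPS
qbinNM-negʳ (+ n)    m = refl
qbinNM-negʳ -[1+ n ] m = refl

-- Both (q)_{n+1} = (q)_n (1 - q^{n+1}) and (q)_{m+1} = (q)_m (1 - q^{m+1}) are peeled off,
-- and q^{n+1} q^{m+1} = q^{n+m+2} recombines the two pieces into (q)_{n+m+2}.
qbinNM-pascal : ∀ n m →
  qbinNM (+ suc n) (+ suc m) ≈ qbinNM (+ n) (+ suc m) ⊕ qPow (suc n) ⊛ qbinNM (+ suc n) (+ m)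
qbinNM-pascal n m = qbinNM-unique (suc n) (suc m) _ (begin
  (Qa ⊕ x ⊛ Qb) ⊛ ((qPoch n ⊛ a) ⊛ (qPoch m ⊛ b))
    ≈⟨ expand Qa Qb x (qPoch n) (qPoch m) a b ⟩
  (Qa ⊛ (qPoch n ⊛ qPoch (suc m))) ⊛ a ⊕ x ⊛ ((Qb ⊛ (qPoch (suc n) ⊛ qPoch m)) ⊛ b)
    ≈⟨ +-cong (⊛-congʳ a (≈-trans (qbinNM-correct n (suc m)) (≡⇒≈ (cong qPoch (ℕ.+-suc n m)))))
              (⊛-congˡ x (⊛-congʳ b (qbinNM-correct (suc n) m))) ⟩
  W ⊛ a ⊕ x ⊛ (W ⊛ b)                      ≈⟨ factor W a x b ⟩
  W ⊛ (a ⊕ x ⊛ b)                          ≈⟨ ⊛-congˡ W a+xb ⟩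
  qPoch (suc (suc (n ℕ.+ m)))              ≈⟨ ≡⇒≈ (cong (λ i → qPoch (suc i)) (sym (ℕ.+-suc n m))) ⟩
  qPoch (suc n ℕ.+ suc m)                  ∎)
  where
  Qa = qbinNM (+ n) (+ suc m)
  Qb = qbinNM (+ suc n) (+ m)
  x = qPow (suc n)
  y = qPow (suc m)
  a = onePS ⊖ x
  b = onePS ⊖ y
  W = qPoch (suc (n ℕ.+ m))
  expand : ∀ Qa Qb x Pn Pm a b → (Qa ⊕ x ⊛ Qb) ⊛ ((Pn ⊛ a) ⊛ (Pm ⊛ b))
                                 ≈ (Qa ⊛ (Pn ⊛ (Pm ⊛ b))) ⊛ a ⊕ x ⊛ ((Qb ⊛ ((Pn ⊛ a) ⊛ Pm)) ⊛ b)
  expand = solve 7 (λ Qa Qb x Pn Pm a b →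
    (Qa :+ x :* Qb) :* ((Pn :* a) :* (Pm :* b))
      := (Qa :* (Pn :* (Pm :* b))) :* a :+ x :* ((Qb :* ((Pn :* a) :* Pm)) :* b))
    (λ _ → refl)
  factor : ∀ W a x b → W ⊛ a ⊕ x ⊛ (W ⊛ b) ≈ W ⊛ (a ⊕ x ⊛ b)
  factor = solve 4 (λ W a x b → W :* a :+ x :* (W :* b) := W :* (a :+ x :* b)) (λ _ → refl)
  telescope : ∀ o x z → (o ⊕ negPS x) ⊕ (x ⊕ negPS z) ≈ o ⊕ negPS z
  telescope = solve 3 (λ o x z → (o :+ :- x) :+ (x :+ :- z) := o :+ :- z) (λ _ → refl)
  a+xb : a ⊕ x ⊛ b ≈ onePS ⊖ qPow (suc (suc (n ℕ.+ m)))
  a+xb = begin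
    a ⊕ x ⊛ (onePS ⊕ negPS y)   ≈⟨ +-cong (≈-refl {a}) (⊛-distribˡ-⊕ x onePS (negPS y)) ⟩
    a ⊕ (x ⊛ onePS ⊕ x ⊛ negPS y)
      ≈⟨ +-cong (≈-refl {a}) (+-cong (*-identityʳ x) (≈-sym (-‿distribʳ-* x y))) ⟩
    a ⊕ (x ⊕ negPS (x ⊛ y))     ≈⟨ telescope onePS x (x ⊛ y) ⟩
    onePS ⊕ negPS (x ⊛ y)       ≈⟨ +-cong (≈-refl {onePS}) (λ k → cong ℤ.-_ (x⊛y k)) ⟩
    onePS ⊖ qPow (suc (suc (n ℕ.+ m))) ∎
    where
    x⊛y : x ⊛ y ≈ qPow (suc (suc (n ℕ.+ m)))
    x⊛y = ≈-trans (qPow-+ (suc n) (suc m)) (≡⇒≈ (cong (λ i → qPow (suc i)) (ℕ.+-suc n m)))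

0≈0+0 : ∀ f → zeroPS ≈ zeroPS ⊕ f ⊛ zeroPS
0≈0+0 f = ≈-sym (≈-trans (+-cong (≈-refl {zeroPS}) (⊛-zeroʳ f)) (+-identityˡ zeroPS))

qbinNM-pascalℤ : ∀ n m → ¬ (n ≡ + 0 × m ≡ + 0) →
  qbinNM n m ≈ qbinNM (n ℤ.- + 1) m ⊕ qPow ℤ.∣ n ∣ ⊛ qbinNM n (m ℤ.- + 1)
qbinNM-pascalℤ -[1+ n ]  m         _ = 0≈0+0 (qPow (suc n))
qbinNM-pascalℤ (+ zero)  -[1+ m ]  _ = 0≈0+0 (qPow 0)
qbinNM-pascalℤ (+ zero)  (+ zero)  ≢0 = ⊥-elim (≢0 (refl , refl))
qbinNM-pascalℤ (+ zero)  (+ suc m) _ = begin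
  qbinNM (+ 0) (+ suc m)             ≈⟨ ≈-trans (qbinNM-0m (suc m)) (≈-sym (qbinNM-0m m)) ⟩
  qbinNM (+ 0) (+ m)                 ≈⟨ ≈-sym (*-identityˡ _) ⟩
  onePS ⊛ qbinNM (+ 0) (+ m)         ≈⟨ ⊛-congʳ (qbinNM (+ 0) (+ m)) (≈-sym qPow-zero) ⟩
  qPow 0 ⊛ qbinNM (+ 0) (+ m)        ≈⟨ ≈-sym (+-identityˡ _) ⟩
  zeroPS ⊕ qPow 0 ⊛ qbinNM (+ 0) (+ m) ∎
qbinNM-pascalℤ (+ suc n) -[1+ m ]  _ = 0≈0+0 (qPow (suc n))
qbinNM-pascalℤ (+ suc n) (+ zero)  _ = begin
  qbinNM (+ suc n) (+ 0)              ≈⟨ ≈-trans (qbinNM-n0 (suc n)) (≈-sym (qbinNM-n0 n)) ⟩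
  qbinNM (+ n) (+ 0)                  ≈⟨ ≈-sym (+-identityʳ _) ⟩
  qbinNM (+ n) (+ 0) ⊕ zeroPS
    ≈⟨ +-cong (≈-refl {qbinNM (+ n) (+ 0)}) (≈-sym (⊛-zeroʳ (qPow (suc n)))) ⟩
  qbinNM (+ n) (+ 0) ⊕ qPow (suc n) ⊛ zeroPS ∎
qbinNM-pascalℤ (+ suc n) (+ suc m) _ = qbinNM-pascal n m

qPow-qbinNM-exchange : ∀ (e e' : ℕ) (X Y m m' : ℤ) → + e ℤ.+ Y ≡ + e' ℤ.+ X →
    (qPow e ⊛ qbinNM X m) ⊛ (qPow ℤ.∣ Y ∣ ⊛ qbinNM Y m')
  ≈ (qPow e' ⊛ qbinNM Y m') ⊛ (qPow ℤ.∣ X ∣ ⊛ qbinNM X m)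
qPow-qbinNM-exchange e e' -[1+ a ] Y m m' _ = begin
  (qPow e ⊛ zeroPS) ⊛ Y′   ≈⟨ ⊛-congʳ Y′ (⊛-zeroʳ (qPow e)) ⟩
  zeroPS ⊛ Y′              ≈⟨ zeroˡ Y′ ⟩
  zeroPS                   ≈⟨ ≈-sym (⊛-zeroʳ Y″) ⟩
  Y″ ⊛ zeroPS              ≈⟨ ≈-sym (⊛-congˡ Y″ (⊛-zeroʳ (qPow (suc a)))) ⟩
  Y″ ⊛ (qPow (suc a) ⊛ zeroPS) ∎
  where
  Y′ = qPow ℤ.∣ Y ∣ ⊛ qbinNM Y m'
  Y″ = qPow e' ⊛ qbinNM Y m'
qPow-qbinNM-exchange e e' (+ a) -[1+ b ] m m' _ = begin
  X′ ⊛ (qPow (suc b) ⊛ zeroPS) ≈⟨ ⊛-congˡ X′ (⊛-zeroʳ (qPow (suc b))) ⟩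
  X′ ⊛ zeroPS                  ≈⟨ ⊛-zeroʳ X′ ⟩
  zeroPS                       ≈⟨ ≈-sym (zeroˡ X″) ⟩
  zeroPS ⊛ X″                  ≈⟨ ≈-sym (⊛-congʳ X″ (⊛-zeroʳ (qPow e'))) ⟩
  (qPow e' ⊛ zeroPS) ⊛ X″      ∎
  where
  X′ = qPow e ⊛ qbinNM (+ a) m
  X″ = qPow a ⊛ qbinNM (+ a) m
qPow-qbinNM-exchange e e' (+ a) (+ b) m m' e+b≡e'+a = begin
  (qPow e ⊛ X) ⊛ (qPow b ⊛ Y)     ≈⟨ interchange (qPow e) X (qPow b) Y ⟩
  (qPow e ⊛ qPow b) ⊛ (X ⊛ Y)     ≈⟨ ⊛-congʳ (X ⊛ Y) (qPow-+ e b) ⟩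
  qPow (e ℕ.+ b) ⊛ (X ⊛ Y)        ≈⟨ ≡⇒≈ (cong (λ i → qPow i ⊛ (X ⊛ Y)) (ℤ.+-injective e+b≡e'+a)) ⟩
  qPow (e' ℕ.+ a) ⊛ (X ⊛ Y)       ≈⟨ ⊛-congʳ (X ⊛ Y) (≈-sym (qPow-+ e' a)) ⟩
  (qPow e' ⊛ qPow a) ⊛ (X ⊛ Y)    ≈⟨ interchange′ (qPow e') (qPow a) X Y ⟩
  (qPow e' ⊛ Y) ⊛ (qPow a ⊛ X)    ∎
  where
  X = qbinNM (+ a) m
  Y = qbinNM (+ b) m'
  interchange : ∀ p x q y → (p ⊛ x) ⊛ (q ⊛ y) ≈ (p ⊛ q) ⊛ (x ⊛ y)
  interchange = solve 4 (λ p x q y → (p :* x) :* (q :* y) := (p :* q) :* (x :* y)) (λ _ → refl)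
  interchange′ : ∀ p q x y → (p ⊛ q) ⊛ (x ⊛ y) ≈ (p ⊛ y) ⊛ (q ⊛ x)
  interchange′ = solve 4 (λ p q x y → (p :* q) :* (x :* y) := (p :* y) :* (q :* x)) (λ _ → refl)

-- Bilateral sums

-1-i≡-[1+i] : ∀ n → ℤ.- + 1 ℤ.- + n ≡ -[1+ n ]
-1-i≡-[1+i] zero    = refl
-1-i≡-[1+i] (suc n) = refl

signZ-reflect : ∀ j → signZ (ℤ.- + 1 ℤ.- j) ≡ ℤ.- signZ j
signZ-reflect (+ n)    = trans (cong signZ (-1-i≡-[1+i] n)) (ℤ.-1*i≡-i (signZ (+ n)))
signZ-reflect -[1+ n ] = sym (trans (cong ℤ.-_ (ℤ.-1*i≡-i (signZ (+ n)))) (ℤ.neg-involutive (signZ (+ n))))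

bisum-cong : ∀ N {F G : ℤ → PS} → (∀ j → F j ≈ G j) → bisum N F ≈ bisum N G
bisum-cong N F≈G k = sumTo-cong (N ℕ.+ N) (λ i _ → F≈G (+ i ℤ.- + N) k)

bisum-⊕ : ∀ N (F G : ℤ → PS) → bisum N (λ j → F j ⊕ G j) ≈ bisum N F ⊕ bisum N G
bisum-⊕ N F G k = sumTo-+ (λ i → F (+ i ℤ.- + N) k) (λ i → G (+ i ℤ.- + N) k) (N ℕ.+ N)

i≡-i⇒i≡0 : ∀ i → i ≡ ℤ.- i → i ≡ + 0
i≡-i⇒i≡0 (+ zero)  _  = refl
i≡-i⇒i≡0 (+ suc n) ()
i≡-i⇒i≡0 -[1+ n ]  ()

-- The terms j and -1-j pair up, leaving the term j = N.
bisum-antisymmetric : ∀ N (G : ℤ → PS) →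
  (∀ j → G (ℤ.- + 1 ℤ.- j) ≈ negPS (G j)) → G (+ N) ≈ zeroPS → bisum N G ≈ zeroPS
bisum-antisymmetric zero    G _    G[N]≈0 k = G[N]≈0 k
bisum-antisymmetric (suc n) G anti G[N]≈0 k =
  cong₂ ℤ._+_ pairs-cancel (trans (cong (λ j → G j k) last≡N) (G[N]≈0 k))
  where
  N = suc n
  T = n ℕ.+ suc n
  f : ℕ → ℤ
  f i = G (+ i ℤ.- + N) k
  last≡N : + suc T ℤ.- + N ≡ + N
  last≡N = trans (cong (λ t → + 1 ℤ.+ t ℤ.- + N) (ℤ.pos-+ n (suc n))) (shift (+ n))
    where
    shift : ∀ x → + 1 ℤ.+ (x ℤ.+ (+ 1 ℤ.+ x)) ℤ.- (+ 1 ℤ.+ x) ≡ + 1 ℤ.+ x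
    shift = solve-∀
  reflect : ∀ i → i ≤ T → + (T ∸ i) ℤ.- + N ≡ ℤ.- + 1 ℤ.- (+ i ℤ.- + N)
  reflect i i≤T = trans (cong (ℤ._- + N) T-i) (mirror (+ n) (+ i))
    where
    T-i : + (T ∸ i) ≡ + n ℤ.+ + N ℤ.- + i
    T-i = trans (sym (trans (ℤ.[+m]-[+n]≡m⊖n T i) (ℤ.⊖-≥ i≤T))) (cong (ℤ._- + i) (ℤ.pos-+ n N))
    mirror : ∀ x y → x ℤ.+ (+ 1 ℤ.+ x) ℤ.- y ℤ.- (+ 1 ℤ.+ x) ≡ ℤ.- + 1 ℤ.- (y ℤ.- (+ 1 ℤ.+ x))
    mirror = solve-∀
  pairs-cancel : sumTo f T ≡ + 0
  pairs-cancel = i≡-i⇒i≡0 _ (trans (sumTo-reverse f T) (trans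
    (sumTo-cong T (λ i i≤T → trans (cong (λ j → G j k) (reflect i i≤T)) (anti (+ i ℤ.- + N) k)))
    (sumTo-neg f T)))

-- The summands of the theorem

+∣i∣*∣i∣≡i*i : ∀ i → + (ℤ.∣ i ∣ ℕ.* ℤ.∣ i ∣) ≡ i ℤ.* i
+∣i∣*∣i∣≡i*i (+ n)    = ℤ.pos-* n n
+∣i∣*∣i∣≡i*i -[1+ n ] = refl

module _ (v L M : ℕ) where

  exponent : ℤ → ℕ
  exponent j = v ℕ.* ℤ.∣ j ∣ ℕ.* ℤ.∣ j ∣

  lowerA lowerB : ℤ → ℤ
  lowerA j = + L ℤ.- + v ℤ.* j
  lowerB j = + L ℤ.+ + v ℤ.+ + v ℤ.* j

  bracketA bracketB bracketB′ : ℤ → PS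
  bracketA j  = qbin (+ L ℤ.+ + M ℤ.- (+ v ℤ.- + 1) ℤ.* j) (lowerA j)
  bracketB j  = qbin (+ L ℤ.+ + v ℤ.+ + M ℤ.+ (+ v ℤ.- + 1) ℤ.* j) (lowerB j)
  bracketB′ j = qbin (+ L ℤ.+ + v ℤ.- + 1 ℤ.+ + M ℤ.+ (+ v ℤ.- + 1) ℤ.* j) (+ L ℤ.+ + v ℤ.- + 1 ℤ.+ + v ℤ.* j)

  lhsSummand rhsSummand : ℤ → PS
  lhsSummand j = signZ j · (qPow (exponent j) ⊛ bracketA j ⊛ bracketB j)
  rhsSummand j = signZ j · (qPow (exponent j) ⊛ bracketA j ⊛ bracketB′ j)

  crossTerm remainder : ℤ → PS
  crossTerm j = (qPow (exponent j) ⊛ qbinNM (lowerA j) (+ M ℤ.+ j))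
              ⊛ (qPow ℤ.∣ lowerB j ∣ ⊛ qbinNM (lowerB j) (+ M ℤ.- + 1 ℤ.- j))
  remainder j = signZ j · crossTerm j

  bracketA≡ : ∀ j → bracketA j ≡ qbinNM (lowerA j) (+ M ℤ.+ j)
  bracketA≡ j = cong (qbinNM (lowerA j)) (difference (+ L) (+ M) (+ v) j)
    where
    difference : ∀ L M v j → L ℤ.+ M ℤ.- (v ℤ.- + 1) ℤ.* j ℤ.- (L ℤ.- v ℤ.* j) ≡ M ℤ.+ j
    difference = solve-∀

  bracketB≡ : ∀ j → bracketB j ≡ qbinNM (lowerB j) (+ M ℤ.- j)
  bracketB≡ j = cong (qbinNM (lowerB j)) (difference (+ L) (+ M) (+ v) j)
    where
    difference : ∀ L M v j → L ℤ.+ v ℤ.+ M ℤ.+ (v ℤ.- + 1) ℤ.* j ℤ.- (L ℤ.+ v ℤ.+ v ℤ.* j) ≡ M ℤ.- j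
    difference = solve-∀

  bracketB′≡ : ∀ j → bracketB′ j ≡ qbinNM (lowerB j ℤ.- + 1) (+ M ℤ.- j)
  bracketB′≡ j = cong₂ qbinNM (bottom (+ L) (+ v) j) (difference (+ L) (+ M) (+ v) j)
    where
    bottom : ∀ L v j → L ℤ.+ v ℤ.- + 1 ℤ.+ v ℤ.* j ≡ L ℤ.+ v ℤ.+ v ℤ.* j ℤ.- + 1
    bottom = solve-∀
    difference : ∀ L M v j →
      L ℤ.+ v ℤ.- + 1 ℤ.+ M ℤ.+ (v ℤ.- + 1) ℤ.* j ℤ.- (L ℤ.+ v ℤ.- + 1 ℤ.+ v ℤ.* j) ≡ M ℤ.- j
    difference = solve-∀

  bracketB-pascal : 1 ≤ v → ∀ j →
    bracketB j ≈ bracketB′ j ⊕ qPow ℤ.∣ lowerB j ∣ ⊛ qbinNM (lowerB j) (+ M ℤ.- + 1 ℤ.- j)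
  bracketB-pascal 1≤v j = begin
    bracketB j
      ≈⟨ ≡⇒≈ (bracketB≡ j) ⟩
    qbinNM (lowerB j) (+ M ℤ.- j)
      ≈⟨ qbinNM-pascalℤ (lowerB j) (+ M ℤ.- j) not-both-zero ⟩
    qbinNM (lowerB j ℤ.- + 1) (+ M ℤ.- j) ⊕ C (+ M ℤ.- j ℤ.- + 1)
      ≈⟨ ≡⇒≈ (cong₂ (λ B m → B ⊕ C m) (sym (bracketB′≡ j)) (swap (+ M) j)) ⟩
    bracketB′ j ⊕ C (+ M ℤ.- + 1 ℤ.- j) ∎
    where
    C : ℤ → PS
    C m = qPow ℤ.∣ lowerB j ∣ ⊛ qbinNM (lowerB j) m
    swap : ∀ M j → M ℤ.- j ℤ.- + 1 ≡ M ℤ.- + 1 ℤ.- j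
    swap = solve-∀
    -- m = M - j = 0 forces j = M ≥ 0, and then n = L + v + v M ≥ v ≥ 1.
    not-both-zero : ¬ (lowerB j ≡ + 0 × + M ℤ.- j ≡ + 0)
    not-both-zero (n≡0 , m≡0) =
      ℕ.<⇒≢ 1≤v (sym (ℕ.m+n≡0⇒n≡0 L (ℕ.m+n≡0⇒m≡0 (L ℕ.+ v) (ℤ.+-injective n≡0′))))
      where
      n≡0′ : + (L ℕ.+ v ℕ.+ v ℕ.* M) ≡ + 0
      n≡0′ = trans (ℤ.pos-+ (L ℕ.+ v) (v ℕ.* M)) (trans (cong₂ ℤ._+_ (ℤ.pos-+ L v) (ℤ.pos-* v M))
        (trans (cong (λ i → + L ℤ.+ + v ℤ.+ + v ℤ.* i) (ℤ.i-j≡0⇒i≡j (+ M) j m≡0)) n≡0))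

  lhsSummand-split : 1 ≤ v → ∀ j → lhsSummand j ≈ rhsSummand j ⊕ remainder j
  lhsSummand-split 1≤v j k = trans (cong (signZ j ℤ.*_) (product-split k)) (ℤ.*-distribˡ-+ (signZ j) _ _)
    where
    P = qPow (exponent j) ⊛ bracketA j
    C = qPow ℤ.∣ lowerB j ∣ ⊛ qbinNM (lowerB j) (+ M ℤ.- + 1 ℤ.- j)
    product-split : P ⊛ bracketB j ≈ P ⊛ bracketB′ j ⊕ crossTerm j
    product-split = begin
      P ⊛ bracketB j             ≈⟨ ⊛-congˡ P (bracketB-pascal 1≤v j) ⟩
      P ⊛ (bracketB′ j ⊕ C)      ≈⟨ ⊛-distribˡ-⊕ P (bracketB′ j) C ⟩
      P ⊛ bracketB′ j ⊕ P ⊛ C    ≈⟨ +-cong (≈-refl {P ⊛ bracketB′ j})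
                                  (≡⇒≈ (cong (λ A → (qPow (exponent j) ⊛ A) ⊛ C) (bracketA≡ j))) ⟩
      P ⊛ bracketB′ j ⊕ crossTerm j ∎

  exponent-reflect : ∀ j → + exponent j ℤ.+ lowerB j ≡ + exponent (ℤ.- + 1 ℤ.- j) ℤ.+ lowerA j
  exponent-reflect j = trans (cong (ℤ._+ lowerB j) (exponent-ℤ j))
    (trans (complete-square (+ v) (+ L) j) (cong (ℤ._+ lowerA j) (sym (exponent-ℤ (ℤ.- + 1 ℤ.- j)))))
    where
    exponent-ℤ : ∀ j → + exponent j ≡ + v ℤ.* (j ℤ.* j)
    exponent-ℤ j = trans (cong +_ (ℕ.*-assoc v ℤ.∣ j ∣ ℤ.∣ j ∣))
      (trans (ℤ.pos-* v _) (cong (+ v ℤ.*_) (+∣i∣*∣i∣≡i*i j)))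
    complete-square : ∀ v L j → v ℤ.* (j ℤ.* j) ℤ.+ (L ℤ.+ v ℤ.+ v ℤ.* j)
                              ≡ v ℤ.* ((ℤ.- + 1 ℤ.- j) ℤ.* (ℤ.- + 1 ℤ.- j)) ℤ.+ (L ℤ.- v ℤ.* j)
    complete-square = solve-∀

  crossTerm-reflect : ∀ j → crossTerm (ℤ.- + 1 ℤ.- j) ≈ crossTerm j
  crossTerm-reflect j = begin
    crossTerm j′
      ≈⟨ ≡⇒≈ (cong₂ (λ A B → (qPow (exponent j′) ⊛ A) ⊛ B)
                 (cong₂ qbinNM (lowerA-reflect (+ L) (+ v) j) (mA-reflect (+ M) j))
                 (cong₂ (λ n m → qPow ℤ.∣ n ∣ ⊛ qbinNM n m)
                        (lowerB-reflect (+ L) (+ v) j) (mB-reflect (+ M) j))) ⟩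
    (qPow (exponent j′) ⊛ qbinNM (lowerB j) (+ M ℤ.- + 1 ℤ.- j))
      ⊛ (qPow ℤ.∣ lowerA j ∣ ⊛ qbinNM (lowerA j) (+ M ℤ.+ j))
      ≈⟨ ≈-sym (qPow-qbinNM-exchange (exponent j) (exponent j′) (lowerA j) (lowerB j)
                  (+ M ℤ.+ j) (+ M ℤ.- + 1 ℤ.- j) (exponent-reflect j)) ⟩
    crossTerm j ∎
    where
    j′ = ℤ.- + 1 ℤ.- j
    lowerA-reflect : ∀ L v j → L ℤ.- v ℤ.* (ℤ.- + 1 ℤ.- j) ≡ L ℤ.+ v ℤ.+ v ℤ.* j
    lowerA-reflect = solve-∀
    lowerB-reflect : ∀ L v j → L ℤ.+ v ℤ.+ v ℤ.* (ℤ.- + 1 ℤ.- j) ≡ L ℤ.- v ℤ.* j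
    lowerB-reflect = solve-∀
    mA-reflect : ∀ M j → M ℤ.+ (ℤ.- + 1 ℤ.- j) ≡ M ℤ.- + 1 ℤ.- j
    mA-reflect = solve-∀
    mB-reflect : ∀ M j → M ℤ.- + 1 ℤ.- (ℤ.- + 1 ℤ.- j) ≡ M ℤ.+ j
    mB-reflect = solve-∀

  remainder-antisymmetric : ∀ j → remainder (ℤ.- + 1 ℤ.- j) ≈ negPS (remainder j)
  remainder-antisymmetric j k = trans (cong₂ ℤ._*_ (signZ-reflect j) (crossTerm-reflect j k))
    (sym (ℤ.neg-distribˡ-* (signZ j) (crossTerm j k)))

  remainder-vanishes : ∀ N → M ≤ N → remainder (+ N) ≈ zeroPS
  remainder-vanishes N M≤N k =
    trans (cong (signZ (+ N) ℤ.*_) (crossTerm≈0 k)) (ℤ.*-zeroʳ (signZ (+ N)))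
    where
    c = N ∸ M
    mB≡- : + M ℤ.- + 1 ℤ.- + N ≡ -[1+ c ]
    mB≡- = trans (cong (λ n → + M ℤ.- + 1 ℤ.- n) N≡M+c) (trans (cancel (+ M) (+ c)) (-1-i≡-[1+i] c))
      where
      N≡M+c : + N ≡ + M ℤ.+ + c
      N≡M+c = trans (cong +_ (sym (ℕ.m+[n∸m]≡n M≤N))) (ℤ.pos-+ M c)
      cancel : ∀ M c → M ℤ.- + 1 ℤ.- (M ℤ.+ c) ≡ ℤ.- + 1 ℤ.- c
      cancel = solve-∀
    crossTerm≈0 : crossTerm (+ N) ≈ zeroPS
    crossTerm≈0 = begin
      P ⊛ (qPow ℤ.∣ lowerB (+ N) ∣ ⊛ qbinNM (lowerB (+ N)) (+ M ℤ.- + 1 ℤ.- + N))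
        ≈⟨ ⊛-congˡ P (⊛-congˡ (qPow ℤ.∣ lowerB (+ N) ∣)
             (≡⇒≈ (trans (cong (qbinNM (lowerB (+ N))) mB≡-) (qbinNM-negʳ (lowerB (+ N)) c)))) ⟩
      P ⊛ (qPow ℤ.∣ lowerB (+ N) ∣ ⊛ zeroPS) ≈⟨ ⊛-congˡ P (⊛-zeroʳ (qPow ℤ.∣ lowerB (+ N) ∣)) ⟩
      P ⊛ zeroPS                             ≈⟨ ⊛-zeroʳ P ⟩
      zeroPS                                 ∎
      where
      P = qPow (exponent (+ N)) ⊛ qbinNM (lowerA (+ N)) (+ M ℤ.+ + N)

theorem5p2 : (v L M : ℕ) → 1 ≤ v → (N : ℕ) → L ℕ.+ M ≤ N →
    bisum N (λ j → signZ j · (qPow (v ℕ.* ℤ.∣ j ∣ ℕ.* ℤ.∣ j ∣)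
        ⊛ qbin (+ L ℤ.+ + M ℤ.- (+ v ℤ.- + 1) ℤ.* j) (+ L ℤ.- + v ℤ.* j)
        ⊛ qbin (+ L ℤ.+ + v ℤ.+ + M ℤ.+ (+ v ℤ.- + 1) ℤ.* j) (+ L ℤ.+ + v ℤ.+ + v ℤ.* j)))
    ≋
    bisum N (λ j → signZ j · (qPow (v ℕ.* ℤ.∣ j ∣ ℕ.* ℤ.∣ j ∣)
        ⊛ qbin (+ L ℤ.+ + M ℤ.- (+ v ℤ.- + 1) ℤ.* j) (+ L ℤ.- + v ℤ.* j)
        ⊛ qbin (+ L ℤ.+ + v ℤ.- + 1 ℤ.+ + M ℤ.+ (+ v ℤ.- + 1) ℤ.* j) (+ L ℤ.+ + v ℤ.- + 1 ℤ.+ + v ℤ.* j)))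
theorem5p2 v L M 1≤v N L+M≤N = begin
  bisum N (lhsSummand v L M)
    ≈⟨ bisum-cong N (lhsSummand-split v L M 1≤v) ⟩
  bisum N (λ j → rhsSummand v L M j ⊕ remainder v L M j)
    ≈⟨ bisum-⊕ N (rhsSummand v L M) (remainder v L M) ⟩
  bisum N (rhsSummand v L M) ⊕ bisum N (remainder v L M)
    ≈⟨ +-cong (≈-refl {bisum N (rhsSummand v L M)}) remainders-cancel ⟩
  bisum N (rhsSummand v L M) ⊕ zeroPS
    ≈⟨ +-identityʳ _ ⟩
  bisum N (rhsSummand v L M) ∎
  where
  remainders-cancel : bisum N (remainder v L M) ≈ zeroPS
  remainders-cancel = bisum-antisymmetric N (remainder v L M) (remainder-antisymmetric v L M)
    (remainder-vanishes v L M N (ℕ.≤-trans (ℕ.m≤n+m M L) L+M≤N))
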